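{- Let $G$ and $H$ be connected graphs with $|V(G)|\geq 2$ and $|V(H)|\geq 2$. Then $$pc(G\Box H)\leq \min\{pc(G),pc(H)\}+1.$$ Moreover, the bound is sharp, i.e., there exist such graphs $G,H$ for which equality holds.
   Context: All graphs are simple, finite and undirected. In an edge-colored graph (adjacent edges may receive the same color), a path is a proper path if no two adjacent edges of the path have the same color. An edge-coloring of a connected graph is a proper-path coloring if every two distinct vertices are joined by a proper path. The proper connection number $pc(G)$ of a connected graph $G$ is the minimum number of colors in a proper-path coloring of $G$. The Cartesian product $G\Box H$ has vertex set $V(G)\times V(H)$, with $(g,h)$ adjacent to $(g',h')$ iff either $g=g'$ and $hh'\in E(H)$, or $h=h'$ and $gg'\in E(G)$. -}

module Defs where

open import Data.Nat using (ℕ; _≤_; _<_; _*_)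
open import Data.Fin using (Fin; remQuot)
open import Data.List using (List; []; _∷_; _++_; [_])
open import Data.List.Relation.Unary.Unique.Propositional using (Unique)
open import Data.List.Relation.Unary.Linked using (Linked)
open import Data.Product using (Σ; _×_; _,_; proj₁; proj₂)
open import Data.Sum using (_⊎_; inj₁; inj₂)
open import Data.Unit using (⊤)
open import Relation.Binary.PropositionalEquality using (_≡_; _≢_; sym)
open import Relation.Nullary using (¬_)

record Graph : Set₁ where
  field
    n     : ℕ
    Adj   : Fin n → Fin n → Set
    adj-sym : ∀ {u v} → Adj u v → Adj v u
    irrefl : ∀ {u} → ¬ Adj u u
open Graph public

PathVertices : ∀ {A : Set} → A → List A → A → List A
PathVertices u mid v = u ∷ (mid ++ [ v ])

IsPath : (G : Graph) → List (Fin (n G)) → Set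
IsPath G ps = Unique ps × Linked (Adj G) ps

Connected : Graph → Set
Connected G = ∀ (u v : Fin (n G)) → u ≢ v →
  Σ (List (Fin (n G))) λ mid → IsPath G (PathVertices u mid v)

-- An edge-coloring with k colors: a symmetric assignment of a color to
-- every (ordered) pair of vertices; only its values on edges matter.
record EdgeColoring (G : Graph) (k : ℕ) : Set where
  field
    col    : Fin (n G) → Fin (n G) → Fin k
    col-sym : ∀ u v → col u v ≡ col v u
open EdgeColoring public

ProperSeq : ∀ {G k} → EdgeColoring G k → List (Fin (n G)) → Set
ProperSeq c (x ∷ y ∷ z ∷ rest) = (col c x y ≢ col c y z) × ProperSeq c (y ∷ z ∷ rest)
ProperSeq c _ = ⊤

ProperPathBetween : ∀ {G k} → EdgeColoring G k → Fin (n G) → Fin (n G) → Set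
ProperPathBetween {G} c u v = Σ (List (Fin (n G))) λ mid →
  IsPath G (PathVertices u mid v) × ProperSeq c (PathVertices u mid v)

IsProperPathColoring : ∀ {G k} → EdgeColoring G k → Set
IsProperPathColoring {G} c = ∀ (u v : Fin (n G)) → u ≢ v → ProperPathBetween c u v

-- G has a proper-path coloring using (at most) k colors.
HasPPC : Graph → ℕ → Set
HasPPC G k = Σ (EdgeColoring G k) IsProperPathColoring

IsPC : Graph → ℕ → Set
IsPC G k = HasPPC G k × (∀ j → j < k → ¬ HasPPC G j)

-- Cartesian product G □ H on Fin (n G * n H); vertex x corresponds to the pair
-- remQuot (n H) x = (g , h) (a bijection Fin (n G * n H) ≃ Fin (n G) × Fin (n H)).
coord : (G H : Graph) → Fin (n G * n H) → Fin (n G) × Fin (n H)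
coord G H x = remQuot {n G} (n H) x

□-Adj : (G H : Graph) → Fin (n G * n H) → Fin (n G * n H) → Set
□-Adj G H x y =
  (proj₁ (coord G H x) ≡ proj₁ (coord G H y)
     × Adj H (proj₂ (coord G H x)) (proj₂ (coord G H y)))
  ⊎ (proj₂ (coord G H x) ≡ proj₂ (coord G H y)
     × Adj G (proj₁ (coord G H x)) (proj₁ (coord G H y)))

□-sym : (G H : Graph) → ∀ {x y} → □-Adj G H x y → □-Adj G H y x
□-sym G H (inj₁ (e , a)) = inj₁ (sym e , adj-sym H a)
□-sym G H (inj₂ (e , a)) = inj₂ (sym e , adj-sym G a)

□-irrefl : (G H : Graph) → ∀ {x} → ¬ □-Adj G H x x
□-irrefl G H (inj₁ (_ , a)) = irrefl H a
□-irrefl G H (inj₂ (_ , a)) = irrefl G a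

_□_ : Graph → Graph → Graph
G □ H = record
  { n = n G * n H
  ; Adj = □-Adj G H
  ; adj-sym = □-sym G H
  ; irrefl = □-irrefl G H
  }

-- Colour every copy of H in G □ H with one fresh colour and every copy of G
-- with the colours of an optimal proper-path colouring of G.  Two vertices in
-- a common copy of G are joined inside that copy.  Otherwise, walk inside the
-- copy of G to a suitable end s of an edge ss′, then climb along a path of H
-- on the ladder spanned by the edge ss′: the steps alternate between the
-- fresh colour and the colour of ss′, and the parity of the path decides
-- which end to start from.  By symmetry pc(G □ H) ≤ min(pc G, pc H) + 1.
-- Equality holds for K₂ □ K₂ = C₄, which needs two colours.
module Submission where

open import Defs
open import Data.Fin using (Fin; zero; suc; fromℕ; inject₁; _≟_)
open import Data.Fin.Properties using (¬Fin0; fromℕ≢inject₁; inject₁-injective; *↔×)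
open import Data.List using (List; []; _∷_; _++_; [_]; map)
open import Data.List.Properties using (map-++; ++-assoc)
open import Data.List.Relation.Unary.All using (All; []; _∷_)
import Data.List.Relation.Unary.All as All
import Data.List.Relation.Unary.All.Properties as All
open import Data.List.Relation.Unary.AllPairs using ([]; _∷_)
import Data.List.Relation.Unary.AllPairs as AllPairs
open import Data.List.Relation.Unary.Linked using (Linked; []; [-]; _∷_)
import Data.List.Relation.Unary.Linked as Linked
import Data.List.Relation.Unary.Linked.Properties as Linked
open import Data.List.Relation.Unary.Unique.Propositional using (Unique)
import Data.List.Relation.Unary.Unique.Propositional.Properties as Unique
open import Data.Nat using (ℕ; suc; _≤_; _<_; _+_; _⊓_; s≤s; z≤n)
open import Data.Nat.Properties using (≮⇒≥; ⊓-glb; +-comm)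
open import Data.Product using (Σ; ∃; _×_; _,_; proj₁; proj₂)
open import Data.Product.Algebra using (×-comm)
open import Data.Sum using (_⊎_; inj₁; inj₂)
import Data.Sum as Sum
open import Data.Unit using (⊤; tt)
open import Function.Base using (_∘_)
open import Function.Bundles using (_↔_; Inverse)
open import Function.Construct.Composition using (_↔-∘_)
open import Relation.Binary.PropositionalEquality
  using (_≡_; _≢_; refl; sym; trans; cong; cong₂; subst; subst₂; ≢-sym)
open import Relation.Nullary using (¬_; yes; no; contradiction)

module _ {V : Set} {k : ℕ} (c : V → V → Fin k) where

  Proper : List V → Set
  Proper (x ∷ y ∷ z ∷ ws) = c x y ≢ c y z × Proper (y ∷ z ∷ ws)
  Proper _                = ⊤

module _ {V : Set} (E : V → V → Set) {k : ℕ} (c : V → V → Fin k) where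

  IsProperPath : List V → Set
  IsProperPath ws = (Unique ws × Linked E ws) × Proper c ws

  ProperPath : V → V → Set
  ProperPath u v = Σ (List V) λ mid → IsProperPath (u ∷ mid ++ [ v ])

EndsWith : ∀ {V : Set} → V → List V → Set
EndsWith {V} v ws = Σ (List V) λ init → ws ≡ init ++ [ v ]

EndsWith-++ : ∀ {V : Set} {v : V} {ys} xs → EndsWith v ys → EndsWith v (xs ++ ys)
EndsWith-++ {v = v} xs (init , eq) = xs ++ init , trans (cong (xs ++_) eq) (sym (++-assoc xs init [ v ]))

module _ {G : Graph} {k : ℕ} (c : EdgeColoring G k) where

  ProperSeq⇒Proper : ∀ ws → ProperSeq c ws → Proper (col c) ws
  ProperSeq⇒Proper (x ∷ y ∷ z ∷ ws) (ne , p) = ne , ProperSeq⇒Proper (y ∷ z ∷ ws) p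
  ProperSeq⇒Proper []               _        = tt
  ProperSeq⇒Proper (_ ∷ [])         _        = tt
  ProperSeq⇒Proper (_ ∷ _ ∷ [])     _        = tt

  Proper⇒ProperSeq : ∀ ws → Proper (col c) ws → ProperSeq c ws
  Proper⇒ProperSeq (x ∷ y ∷ z ∷ ws) (ne , p) = ne , Proper⇒ProperSeq (y ∷ z ∷ ws) p
  Proper⇒ProperSeq []               _        = tt
  Proper⇒ProperSeq (_ ∷ [])         _        = tt
  Proper⇒ProperSeq (_ ∷ _ ∷ [])     _        = tt

  ProperPathBetween⇒ProperPath : ∀ {u v} → ProperPathBetween c u v → ProperPath (Adj G) (col c) u v
  ProperPathBetween⇒ProperPath (mid , path , p) = mid , path , ProperSeq⇒Proper _ p

  ProperPath⇒ProperPathBetween : ∀ {u v} → ProperPath (Adj G) (col c) u v → ProperPathBetween c u v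
  ProperPath⇒ProperPathBetween (mid , path , p) = mid , path , Proper⇒ProperSeq _ p

module _ {V : Set} {E : V → V → Set} {k : ℕ} {c : V → V → Fin k} where

  properPath-endsWith : ∀ {u v ws} → IsProperPath E c (u ∷ ws) → EndsWith v ws → ProperPath E c u v
  properPath-endsWith p (init , refl) = init , p

  -- Gluing at the vertex v: the only new pair of consecutive edges is the
  -- one through v, whose properness is the condition on u.
  module _ {v : V} {ys : List V} where

    unique-glue : ∀ xs → Unique (xs ++ [ v ]) → Unique (v ∷ ys) →
                  All (λ u → All (u ≢_) ys) xs → Unique (xs ++ v ∷ ys)
    unique-glue []       _           vys _            = vys
    unique-glue (x ∷ xs) (x∉ ∷ xsv) vys (x∉ys ∷ xs∉ys) =
      All.++⁺ (All.++⁻ˡ xs x∉) (All.head (All.++⁻ʳ xs x∉) ∷ x∉ys) ∷ unique-glue xs xsv vys xs∉ys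

    linked-glue : ∀ xs → Linked E (xs ++ [ v ]) → Linked E (v ∷ ys) → Linked E (xs ++ v ∷ ys)
    linked-glue []           _       vys = vys
    linked-glue (_ ∷ [])     (e ∷ _) vys = e ∷ vys
    linked-glue (_ ∷ y ∷ xs) (e ∷ l) vys = e ∷ linked-glue (y ∷ xs) l vys

    proper-glue : ∀ xs → Linked E (xs ++ [ v ]) → Proper c (xs ++ [ v ]) → Proper c (v ∷ ys) →
                  All (λ u → E u v → Proper c (u ∷ v ∷ ys)) xs → Proper c (xs ++ v ∷ ys)
    proper-glue []               _       _        pvys _           = pvys
    proper-glue (_ ∷ [])         (e ∷ _) _        _    (ok ∷ [])   = ok e
    proper-glue (_ ∷ y ∷ [])     (_ ∷ l) (ne , p) pvys (_ ∷ oks)   =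
      ne , proper-glue (y ∷ []) l p pvys oks
    proper-glue (_ ∷ y ∷ z ∷ xs) (_ ∷ l) (ne , p) pvys (_ ∷ oks)   =
      ne , proper-glue (y ∷ z ∷ xs) l p pvys oks

    isProperPath-glue : ∀ xs → IsProperPath E c (xs ++ [ v ]) → IsProperPath E c (v ∷ ys) →
                        All (λ u → All (u ≢_) ys) xs → All (λ u → E u v → Proper c (u ∷ v ∷ ys)) xs →
                        IsProperPath E c (xs ++ v ∷ ys)
    isProperPath-glue xs ((u₁ , l₁) , p₁) ((u₂ , l₂) , p₂) disjoint junction =
      (unique-glue xs u₁ u₂ disjoint , linked-glue xs l₁ l₂) , proper-glue xs l₁ p₁ p₂ junction

module _ {V W : Set} {E : V → V → Set} {E′ : W → W → Set} {k k′ : ℕ}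
         {c : V → V → Fin k} {c′ : W → W → Fin k′}
         (f : V → W) (f-injective : ∀ {u v} → f u ≡ f v → u ≡ v)
         (f-edge : ∀ {u v} → E u v → E′ (f u) (f v))
         (f-proper : ∀ {u v w} → E u v → E v w → c u v ≢ c v w → c′ (f u) (f v) ≢ c′ (f v) (f w))
         where

  map-proper : ∀ {ws} → Linked E ws → Proper c ws → Proper c′ (map f ws)
  map-proper []                _        = tt
  map-proper [-]               _        = tt
  map-proper (_ ∷ [-])         _        = tt
  map-proper (e ∷ l@(e′ ∷ _)) (ne , p) = f-proper e e′ ne , map-proper l p

  map-isProperPath : ∀ {ws} → IsProperPath E c ws → IsProperPath E′ c′ (map f ws)
  map-isProperPath ((u , l) , p) =
    (Unique.map⁺ f-injective u , Linked.map⁺ (Linked.map f-edge l)) , map-proper l p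

  map-properPath : ∀ {u v} → ProperPath E c u v → ProperPath E′ c′ (f u) (f v)
  map-properPath {u} {v} (mid , p) =
    map f mid , subst (IsProperPath E′ c′) (cong (f u ∷_) (map-++ f mid [ v ])) (map-isProperPath p)

IsProperPathColoring⇒Connected : ∀ {G k} {c : EdgeColoring G k} → IsProperPathColoring c → Connected G
IsProperPathColoring⇒Connected pp u v u≢v = proj₁ (pp u v u≢v) , proj₁ (proj₂ (pp u v u≢v))

adj⇒≢ : ∀ G {x y} → Adj G x y → x ≢ y
adj⇒≢ G e refl = irrefl G e

other-vertex : ∀ {m} → 2 ≤ m → (x : Fin m) → ∃ (x ≢_)
other-vertex (s≤s (s≤s _)) zero    = suc zero , λ ()
other-vertex (s≤s (s≤s _)) (suc _) = zero , λ ()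

neighbour : ∀ {G} → Connected G → 2 ≤ n G → ∀ x → ∃ (Adj G x)
neighbour con two x with other-vertex two x
... | y , x≢y with con x y x≢y
...   | []    , _ , e ∷ _ = y , e
...   | m ∷ _ , _ , e ∷ _ = m , e

hasPPC-transport : ∀ {W : Set} {E : W → W → Set} {k} (P : Graph) (ι : Fin (n P) ↔ W) →
                (∀ {x y} → E (Inverse.to ι x) (Inverse.to ι y) → Adj P x y) →
                (c : W → W → Fin k) → (∀ u v → c u v ≡ c v u) →
                (∀ u v → u ≢ v → ProperPath E c u v) → HasPPC P k
hasPPC-transport {E = E} P ι adj c c-sym paths = colouring , proper
  where
    open Inverse ι using (to; from; strictlyInverseˡ; strictlyInverseʳ)

    colouring : EdgeColoring P _
    colouring = record { col = λ x y → c (to x) (to y) ; col-sym = λ x y → c-sym (to x) (to y) }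

    from-injective : ∀ {u v} → from u ≡ from v → u ≡ v
    from-injective {u} {v} eq =
      trans (sym (strictlyInverseˡ u)) (trans (cong to eq) (strictlyInverseˡ v))

    from-edge : ∀ {u v} → E u v → Adj P (from u) (from v)
    from-edge {u} {v} e = adj (subst₂ E (sym (strictlyInverseˡ u)) (sym (strictlyInverseˡ v)) e)

    col-from : ∀ u v → col colouring (from u) (from v) ≡ c u v
    col-from u v = cong₂ c (strictlyInverseˡ u) (strictlyInverseˡ v)

    from-proper : ∀ {u v w} → E u v → E v w → c u v ≢ c v w →
                  col colouring (from u) (from v) ≢ col colouring (from v) (from w)
    from-proper {u} {v} {w} _ _ ne eq = ne (trans (sym (col-from u v)) (trans eq (col-from v w)))

    to-injective : ∀ {x y} → to x ≡ to y → x ≡ y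
    to-injective {x} {y} eq =
      trans (sym (strictlyInverseʳ x)) (trans (cong from eq) (strictlyInverseʳ y))

    proper : IsProperPathColoring colouring
    proper x y x≢y =
      ProperPath⇒ProperPathBetween colouring
        (subst₂ (ProperPath (Adj P) (col colouring)) (strictlyInverseʳ x) (strictlyInverseʳ y)
          (map-properPath from from-injective from-edge from-proper
            (paths (to x) (to y) (x≢y ∘ to-injective))))

-- □-Adj G H x y is PairAdj G H (coord G H x) (coord G H y) by definition.
PairAdj : (G H : Graph) → Fin (n G) × Fin (n H) → Fin (n G) × Fin (n H) → Set
PairAdj G H (g , h) (g′ , h′) = (g ≡ g′ × Adj H h h′) ⊎ (h ≡ h′ × Adj G g g′)

module LayeredColouring (G H : Graph) (conG : Connected G) (twoG : 2 ≤ n G) (conH : Connected H)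
                        {a : ℕ} (cG : EdgeColoring G a) (ppcG : IsProperPathColoring cG) where

  Vertex : Set
  Vertex = Fin (n G) × Fin (n H)

  colour : Vertex → Vertex → Fin (suc a)
  colour (g , _) (g′ , _) with g ≟ g′
  ... | yes _ = fromℕ a
  ... | no _  = inject₁ (col cG g g′)

  colour-sym : ∀ u v → colour u v ≡ colour v u
  colour-sym (g , _) (g′ , _) with g ≟ g′ | g′ ≟ g
  ... | yes _  | yes _  = refl
  ... | no _   | no _   = cong inject₁ (col-sym cG g g′)
  ... | yes eq | no ne  = contradiction (sym eq) ne
  ... | no ne  | yes eq = contradiction (sym eq) ne

  colour-fibre : ∀ g h h′ → colour (g , h) (g , h′) ≡ fromℕ a
  colour-fibre g _ _ with g ≟ g
  ... | yes _ = refl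
  ... | no ne = contradiction refl ne

  colour-layer : ∀ {g g′} h h′ → g ≢ g′ → colour (g , h) (g′ , h′) ≡ inject₁ (col cG g g′)
  colour-layer {g} {g′} _ _ ne with g ≟ g′
  ... | yes eq = contradiction eq ne
  ... | no _   = refl

  fibre≢layer : ∀ x h₁ h₂ {g g′} h₃ h₄ → g ≢ g′ → colour (x , h₁) (x , h₂) ≢ colour (g , h₃) (g′ , h₄)
  fibre≢layer x h₁ h₂ h₃ h₄ ne eq =
    fromℕ≢inject₁ (trans (sym (colour-fibre x h₁ h₂)) (trans eq (colour-layer h₃ h₄ ne)))

  layer : Fin (n H) → Fin (n G) → Vertex
  layer h g = g , h

  layer-properPath : ∀ h {g g′} → ProperPath (Adj G) (col cG) g g′ →
                     ProperPath (PairAdj G H) colour (g , h) (g′ , h)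
  layer-properPath h = map-properPath (layer h) (cong proj₁) (λ e → inj₂ (refl , e)) proper
    where
      proper : ∀ {u v w} → Adj G u v → Adj G v w → col cG u v ≢ col cG v w →
               colour (u , h) (v , h) ≢ colour (v , h) (w , h)
      proper e e′ ne eq = ne (inject₁-injective
        (trans (sym (colour-layer h h (adj⇒≢ G e))) (trans eq (colour-layer h h (adj⇒≢ G e′)))))

  -- The rungs {x , y} × {h}, h ∈ hs, each traversed from the column in which
  -- the previous one ended.
  ladder : Fin (n G) → Fin (n G) → List (Fin (n H)) → List Vertex
  ladder x y []       = []
  ladder x y (h ∷ hs) = (x , h) ∷ (y , h) ∷ ladder y x hs

  ladder-levels : ∀ {P : Fin (n H) → Set} x y {hs} → All P hs → All (P ∘ proj₂) (ladder x y hs)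
  ladder-levels x y []         = []
  ladder-levels x y (ph ∷ phs) = ph ∷ ph ∷ ladder-levels y x phs

  ladder-avoids : ∀ {h} x y {hs} → All (h ≢_) hs → All (λ v → ∀ g → (g , h) ≢ v) (ladder x y hs)
  ladder-avoids x y h∉hs = All.map (λ h≢ g eq → h≢ (cong proj₂ eq)) (ladder-levels x y h∉hs)

  ladder-unique : ∀ {x y hs} → x ≢ y → Unique hs → Unique (ladder x y hs)
  ladder-unique {hs = []}              _   []           = []
  ladder-unique {x} {y} {hs = h ∷ hs} x≢y (h∉hs ∷ uhs) =
    ((x≢y ∘ cong proj₁) ∷ All.map (λ p → p x) (ladder-avoids y x h∉hs))
    ∷ All.map (λ p → p y) (ladder-avoids y x h∉hs)
    ∷ ladder-unique (x≢y ∘ sym) uhs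

  ladder-linked : ∀ {x y h hs} → Adj G x y → Linked (Adj H) (h ∷ hs) →
                  Linked (PairAdj G H) ((x , h) ∷ ladder x y hs)
  ladder-linked _  [-]     = [-]
  ladder-linked xy (e ∷ l) = inj₁ (refl , e) ∷ inj₂ (refl , xy) ∷ ladder-linked (adj-sym G xy) l

  ladder-proper : ∀ {x y} h hs → x ≢ y → Proper colour ((x , h) ∷ ladder x y hs)
  ladder-proper     _ []             _   = tt
  ladder-proper {x} h (h₁ ∷ [])      x≢y = fibre≢layer x h h₁ h₁ h₁ x≢y , tt
  ladder-proper {x} {y} h (h₁ ∷ h₂ ∷ hs) x≢y =
    fibre≢layer x h h₁ h₁ h₁ x≢y , fibre≢layer y h₁ h₂ h₁ h₁ x≢y ∘ sym ,
    ladder-proper h₁ (h₂ ∷ hs) (x≢y ∘ sym)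

  ladder-isProperPath : ∀ {x y h hs} → Adj G x y → IsPath H (h ∷ hs) →
                        IsProperPath (PairAdj G H) colour ((x , h) ∷ ladder x y hs)
  ladder-isProperPath {x} {y} {h} {hs} xy (h∉hs ∷ uhs , l) =
    (All.map (λ p → p x) (ladder-avoids x y h∉hs) ∷ ladder-unique (adj⇒≢ G xy) uhs , ladder-linked xy l)
    , ladder-proper h hs (adj⇒≢ G xy)

  ladder-ends : ∀ x y ms h → EndsWith (y , h) (ladder x y (ms ++ [ h ])) ⊎ EndsWith (y , h) (ladder y x (ms ++ [ h ]))
  ladder-ends x y []       h = inj₁ ((x , h) ∷ [] , refl)
  ladder-ends x y (m ∷ ms) h with ladder-ends x y ms h
  ... | inj₁ (init , eq) = inj₂ ((y , m) ∷ (x , m) ∷ init , cong (λ ws → (y , m) ∷ (x , m) ∷ ws) eq)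
  ... | inj₂ (init , eq) = inj₁ ((x , m) ∷ (y , m) ∷ init , cong (λ ws → (x , m) ∷ (y , m) ∷ ws) eq)

  layer-ladder-proper : ∀ {x s s′} h hs → x ≢ s → s ≢ s′ → Proper colour ((x , h) ∷ (s , h) ∷ ladder s s′ hs)
  layer-ladder-proper     _ []       _   _    = tt
  layer-ladder-proper {s = s} h (h₁ ∷ hs) x≢s s≢s′ =
    fibre≢layer s h h₁ h h x≢s ∘ sym , ladder-proper h (h₁ ∷ hs) s≢s′

  walk-then-climb : ∀ {x s s′ h hs v} → x ≢ s → Adj G s s′ → IsPath H (h ∷ hs) → EndsWith v (ladder s s′ hs) →
                    ProperPath (PairAdj G H) colour (x , h) v
  walk-then-climb {x} {s} {s′} {h} {hs} x≢s ss′ pathH ends =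
    properPath-endsWith
      (isProperPath-glue ((x , h) ∷ proj₁ layerPath) (proj₂ layerPath) (ladder-isProperPath ss′ pathH)
        (All.map⁺ (All.universal (λ y → All.map (λ p → p y) (ladder-avoids s s′ h∉hs)) (x ∷ midG)))
        (All.map⁺ (All.universal junction (x ∷ midG))))
      (EndsWith-++ (proj₁ layerPath) (EndsWith-++ [ (s , h) ] ends))
    where
      pathG = ProperPathBetween⇒ProperPath cG (ppcG x s x≢s)
      midG = proj₁ pathG
      layerPath = layer-properPath h pathG
      h∉hs = AllPairs.head (proj₁ pathH)

      junction : ∀ y → PairAdj G H (y , h) (s , h) → Proper colour ((y , h) ∷ (s , h) ∷ ladder s s′ hs)
      junction y (inj₁ (_ , hh)) = contradiction hh (irrefl H)
      junction y (inj₂ (_ , ys)) = layer-ladder-proper h hs (adj⇒≢ G ys) (adj⇒≢ G ss′)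

  walk-or-climb : ∀ {x s s′ h hs v} → Adj G s s′ → IsPath H (h ∷ hs) → EndsWith v (ladder s s′ hs) →
                  ProperPath (PairAdj G H) colour (x , h) v
  walk-or-climb {x} {s} ss′ pathH ends with x ≟ s
  ... | yes refl = properPath-endsWith (ladder-isProperPath ss′ pathH) ends
  ... | no x≢s   = walk-then-climb x≢s ss′ pathH ends

  properPaths : ∀ u v → u ≢ v → ProperPath (PairAdj G H) colour u v
  properPaths (g , h) (g′ , h′) u≢v with h ≟ h′
  ... | yes refl = layer-properPath h (ProperPathBetween⇒ProperPath cG (ppcG g g′ (u≢v ∘ cong (layer h))))
  ... | no h≢h′ with conH h h′ h≢h′ | neighbour {G} conG twoG g′
  ...   | midH , pathH | q , g′q with ladder-ends q g′ midH h′
  ...     | inj₁ ends = walk-or-climb (adj-sym G g′q) pathH ends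
  ...     | inj₂ ends = walk-or-climb g′q pathH ends

□-hasPPCˡ : ∀ {G H a} → Connected G → 2 ≤ n G → Connected H → HasPPC G a → HasPPC (G □ H) (suc a)
□-hasPPCˡ {G} {H} conG twoG conH (cG , ppcG) =
  hasPPC-transport (G □ H) *↔× (λ e → e) colour colour-sym properPaths
  where open LayeredColouring G H conG twoG conH cG ppcG

□-hasPPCʳ : ∀ {G H b} → Connected G → Connected H → 2 ≤ n H → HasPPC H b → HasPPC (G □ H) (suc b)
□-hasPPCʳ {G} {H} conG conH twoH (cH , ppcH) =
  hasPPC-transport (G □ H) (×-comm _ _ ↔-∘ *↔×) Sum.swap colour colour-sym properPaths
  where open LayeredColouring H G conH twoH conG cH ppcH

IsPC⇒≤ : ∀ {G c k} → IsPC G c → HasPPC G k → c ≤ k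
IsPC⇒≤ (_ , minimal) has = ≮⇒≥ (λ k<c → minimal _ k<c has)

pc-□-≤ : ∀ (G H : Graph) → Connected G → Connected H → 2 ≤ n G → 2 ≤ n H →
         ∀ (a b c : ℕ) → IsPC G a → IsPC H b → IsPC (G □ H) c → c ≤ (a ⊓ b) + 1
pc-□-≤ G H conG conH twoG twoH a b c (hasG , _) (hasH , _) pcGH =
  subst (c ≤_) (+-comm 1 (a ⊓ b))
    (⊓-glb (IsPC⇒≤ pcGH (□-hasPPCˡ conG twoG conH hasG)) (IsPC⇒≤ pcGH (□-hasPPCʳ conG conH twoH hasH)))

K : ℕ → Graph
K m = record { n = m ; Adj = _≢_ ; adj-sym = ≢-sym ; irrefl = λ ne → ne refl }

K-hasPPC₁ : ∀ m → HasPPC (K m) 1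
K-hasPPC₁ m = record { col = λ _ _ → zero ; col-sym = λ _ _ → refl } ,
              λ u v u≢v → [] , ((u≢v ∷ []) ∷ [] ∷ [] , u≢v ∷ [-]) , tt

K-connected : ∀ m → Connected (K m)
K-connected m = IsProperPathColoring⇒Connected (proj₂ (K-hasPPC₁ m))

¬EdgeColoring₀ : ∀ {G} → Fin (n G) → ¬ EdgeColoring G 0
¬EdgeColoring₀ v c = ¬Fin0 (col c v v)

Fin1-≡ : (i j : Fin 1) → i ≡ j
Fin1-≡ zero zero = refl

hasPPC₁⇒adjacent : ∀ {G} → HasPPC G 1 → ∀ u v → u ≢ v → Adj G u v
hasPPC₁⇒adjacent (c , pp) u v u≢v with pp u v u≢v
... | []         , (_ , e ∷ _) , _      = e
... | _ ∷ []     , _           , ne , _ = contradiction (Fin1-≡ _ _) ne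
... | _ ∷ _ ∷ _  , _           , ne , _ = contradiction (Fin1-≡ _ _) ne

pc-K₂ : IsPC (K 2) 1
pc-K₂ = K-hasPPC₁ 2 , below
  where
    below : ∀ j → j < 1 → ¬ HasPPC (K 2) j
    below 0       _         (c , _) = ¬EdgeColoring₀ zero c
    below (suc _) (s≤s ())

pc-K₂□K₂ : IsPC (K 2 □ K 2) 2
pc-K₂□K₂ = □-hasPPCˡ (K-connected 2) (s≤s (s≤s z≤n)) (K-connected 2) (K-hasPPC₁ 2) , below
  where
    opposite-corners : ¬ Adj (K 2 □ K 2) zero (suc (suc (suc zero)))
    opposite-corners (inj₁ (() , _))
    opposite-corners (inj₂ (() , _))

    below : ∀ j → j < 2 → ¬ HasPPC (K 2 □ K 2) j
    below 0             _               (c , _) = ¬EdgeColoring₀ zero c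
    below 1             _               has     =
      opposite-corners (hasPPC₁⇒adjacent has zero (suc (suc (suc zero))) λ ())
    below (suc (suc _)) (s≤s (s≤s ()))

theorem1 : (∀ (G H : Graph) → Connected G → Connected H → 2 ≤ n G → 2 ≤ n H →
    ∀ (a b c : ℕ) → IsPC G a → IsPC H b → IsPC (G □ H) c →
    c ≤ (a ⊓ b) + 1)
    × (Σ Graph λ G → Σ Graph λ H →
    Connected G × Connected H × 2 ≤ n G × 2 ≤ n H ×
    Σ ℕ λ a → Σ ℕ λ b → Σ ℕ λ c →
    IsPC G a × IsPC H b × IsPC (G □ H) c × c ≡ (a ⊓ b) + 1)
theorem1 =
  pc-□-≤ ,
  (K 2 , K 2 , K-connected 2 , K-connected 2 , s≤s (s≤s z≤n) , s≤s (s≤s z≤n) ,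
   1 , 1 , 2 , pc-K₂ , pc-K₂ , pc-K₂□K₂ , refl)
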